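{- Let $m = p + 12k$ with $k \geqslant 0$ an integer and $p \in \{11,13,17,19\}$. Suppose that $(W, X, Y, Z, P^0_0, P^1_0, Q^0_0, Q^1_0)$ is a type-2 basic set of dipaths of $G_{2m}$. For $i \in \{0,1\}$ and $j \in \{1,\ldots,k-1\}$ let $P^i_j = \rho^{12j}(P^i_0)$ and $Q^i_j = \rho^{12j}(Q^i_0)$. Then $C^0 = W P^0_0 P^0_1 \cdots P^0_{k-1} X P^1_0 P^1_1 \cdots P^1_{k-1}$ and $C^1 = Y Q^0_0 Q^0_1 \cdots Q^0_{k-1} Z Q^1_0 Q^1_1 \cdots Q^1_{k-1}$ (concatenations of dipaths; when $k=0$ these are $WX$ and $YZ$) are type-2 directed $m$-cycles, and $C^0 \cup C^1$ is a $\vec{C}_m$-factor of $G_{2m}$.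
   Context: Let $m$ be odd. $G_{2m} = \vec{X}(m,\{1,3\}) \wr K^*_2$, where $\vec{X}(m,\{1,3\})$ has vertex set $\mathbb{Z}_m$ and arcs $(a,a+1),(a,a+3)$ (mod $m$), $K^*_2$ is the complete symmetric digraph on $\{x,y\}$, and the wreath product $G\wr H$ has vertex set $V(G)\times V(H)$ with an arc $(g_1,h_1)\to(g_2,h_2)$ iff $(g_1,g_2)\in A(G)$, or $g_1=g_2$ and $(h_1,h_2)\in A(H)$. Write $x_a=(a,x)$, $y_b=(b,y)$. An arc from a vertex with subscript $a$ to a vertex with subscript $b$ has difference $b-a \bmod m$ (in $\{0,1,3\}$); a directed walk's arcs "sum up to" the sum of their differences; a type-$k$ cycle is a directed $m$-cycle whose arcs sum up to $km$. $\rho: V(G_{2m})\to V(G_{2m})$ is $\rho(x_i)=x_{i+1}$, $\rho(y_i)=y_{i+1}$ (indices mod $m$), extended to dipaths. With $m=p+12k$: $V_0=\{x_0,\ldots,x_{p-1}\}\cup\{y_0,\ldots,y_{p-1}\}$ and, for $i=1,\ldots,k$, $V_i=\{x_t,y_t : p+12(i-1)\le t\le p+12i-1\}$. For a dipath $P$, $s(P)$ is its first vertex, $t(P)$ its last, $\mathrm{len}(P)$ its number of arcs; $PQ$ denotes concatenation when $t(P)=s(Q)$. An 8-tuple $(W,X,Y,Z,Q,R,S,T)$ of dipaths of $G_{2m}$ is a type-2 basic set of dipaths if: (C1) $Q,R,S,T$ are pairwise disjoint; if $k\ge1$ then $W,X,Y,Z$ are pairwise disjoint, otherwise $WX$ and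 $YZ$ are disjoint type-2 directed cycles; (C2) $s(X)=\rho^{ -p}(t(W))$, $s(W)=\rho^{ -p}(t(X))$, $s(Z)=\rho^{ -p}(t(Y))$, $s(Y)=\rho^{ -p}(t(Z))$; (C3) $\mathrm{len}(W)+\mathrm{len}(X)=\mathrm{len}(Y)+\mathrm{len}(Z)=p$; $\mathrm{len}(Q)+\mathrm{len}(R)=\mathrm{len}(S)+\mathrm{len}(T)=12$ if $k\ge1$, and $\mathrm{len}(Q)=\mathrm{len}(R)=\mathrm{len}(S)=\mathrm{len}(T)=0$ otherwise; (C4) each of $W,X,Y,Z$ has its source and internal vertices in $V_0$ and its terminus equal to $x_t$ or $y_t$ for some $t\in\{p,p+1,p+2\}$; (C5) $t(W)=s(Q)$, $t(X)=s(R)$, $t(Y)=s(S)$, $t(Z)=s(T)$; (C6) if $k\ge1$ and $P\in\{Q,R,S,T\}$ has $s(P)=x_t$ (resp. $y_t$), then $t(P)=x_{t+12}$ (resp. $y_{t+12}$) and all internal vertices of $P$ lie in $V_1$. A $\vec{C}_m$-factor is a spanning subdigraph that is a disjoint union of directed $m$-cycles. -}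

module Defs where

open import Data.Nat using (ℕ; zero; suc; _+_; _*_; _∸_; _≤_; _<_; _%_)
open import Data.Nat.DivMod using (m%n<n)
open import Data.Fin using (Fin; toℕ; fromℕ<)
open import Data.Product using (_×_; _,_; proj₁; proj₂; ∃-syntax)
open import Data.Sum using (_⊎_)
open import Data.Empty using (⊥)
open import Data.List using (List; []; _∷_; _++_; map; length; upTo)
open import Data.List.Relation.Unary.All using (All)
open import Data.List.Relation.Unary.Any using (Any)
open import Data.List.Relation.Unary.AllPairs using (AllPairs)
open import Data.List.Relation.Unary.Linked using (Linked)
open import Data.List.Relation.Unary.Unique.Propositional using (Unique)
open import Data.List.Membership.Propositional using (_∈_)
open import Relation.Binary.PropositionalEquality using (_≡_; _≢_)

-- The two vertices x, y of K*_2
data Side : Set where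
  xS yS : Side

-- Vertices of G_{2m}: x_a = (a , xS), y_a = (a , yS), a ∈ Z_m
Vtx : ℕ → Set
Vtx m = Fin m × Side

addF : ∀ {m} → Fin m → ℕ → Fin m
addF {suc n} a d = fromℕ< (m%n<n (toℕ a + d) (suc n))

-- t mod m (t itself if m = 0, never used)
modℕ : ℕ → ℕ → ℕ
modℕ zero t = t
modℕ (suc n) t = t % suc n

rho : ∀ {m} → ℕ → Vtx m → Vtx m
rho j (a , s) = addF a j , s

-- arcs of G_{2m} = X(m,{1,3}) wr K*_2
Arc : ∀ {m} → Vtx m → Vtx m → Set
Arc (a , s) (b , t) = (b ≡ addF a 1) ⊎ (b ≡ addF a 3) ⊎ (a ≡ b × s ≢ t)

diff : ∀ {m} → Vtx m → Vtx m → ℕ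
diff {zero} (() , _) _
diff {suc n} (a , _) (b , _) = (toℕ b + (suc n ∸ toℕ a)) % suc n

-- A walk given by its first vertex and the list of the remaining vertices
Walk : ℕ → Set
Walk m = Vtx m × List (Vtx m)

verts : ∀ {m} → Walk m → List (Vtx m)
verts (v , vs) = v ∷ vs

src : ∀ {m} → Walk m → Vtx m
src = proj₁

lastV : ∀ {m} → Vtx m → List (Vtx m) → Vtx m
lastV v [] = v
lastV v (u ∷ us) = lastV u us

tgt : ∀ {m} → Walk m → Vtx m
tgt (v , vs) = lastV v vs

len : ∀ {m} → Walk m → ℕ
len (v , vs) = length vs

initL : ∀ {m} → Vtx m → List (Vtx m) → List (Vtx m)
initL v [] = []
initL v (u ∷ us) = v ∷ initL u us

initV : ∀ {m} → Walk m → List (Vtx m)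
initV (v , vs) = initL v vs

internals : ∀ {m} → Walk m → List (Vtx m)
internals (v , []) = []
internals (v , u ∷ us) = initL u us

arcSum : ∀ {m} → Vtx m → List (Vtx m) → ℕ
arcSum v [] = 0
arcSum v (u ∷ us) = diff v u + arcSum u us

IsWalk : ∀ {m} → Walk m → Set
IsWalk w = Linked Arc (verts w)

IsDipath : ∀ {m} → Walk m → Set
IsDipath w = IsWalk w × Unique (verts w)

-- directed m-cycle, as a closed walk v0 v1 ... v_{m-1} v0
IsDirCycle : ∀ {m} → Walk m → Set
IsDirCycle {m} w = IsWalk w × tgt w ≡ src w × len w ≡ m × Unique (proj₂ w)

IsType2Cycle : ∀ {m} → Walk m → Set
IsType2Cycle {m} w = IsDirCycle w × arcSum (proj₁ w) (proj₂ w) ≡ 2 * m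

Disjoint : ∀ {m} → Walk m → Walk m → Set
Disjoint P Q = ∀ v → v ∈ verts P → v ∈ verts Q → ⊥

-- concatenation PQ (meaningful when t(P) = s(Q))
_⊙_ : ∀ {m} → Walk m → Walk m → Walk m
(v , vs) ⊙ (u , us) = v , vs ++ us

concatW : ∀ {m} → Walk m → List (Walk m) → Walk m
concatW w [] = w
concatW w (p ∷ ps) = concatW (w ⊙ p) ps

shiftW : ∀ {m} → ℕ → Walk m → Walk m
shiftW j (v , vs) = rho j v , map (rho j) vs

pieces : ∀ {m} → ℕ → Walk m → List (Walk m)
pieces zero P = []
pieces (suc k) P = P ∷ map (λ j → shiftW (12 * suc j) P) (upTo k)

cycleOf : ∀ {m} → ℕ → Walk m → Walk m → Walk m → Walk m → Walk m
cycleOf k A P B R = concatW A (pieces k P ++ (B ∷ pieces k R))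

InV0 : ∀ {m} → ℕ → Vtx m → Set
InV0 p (a , _) = toℕ a < p

InV1 : ∀ {m} → ℕ → Vtx m → Set
InV1 p (a , _) = p ≤ toℕ a × toℕ a < p + 12

C4 : ∀ {m} → ℕ → Walk m → Set
C4 {m} p w = All (InV0 p) (initV w)
  × ∃[ e ] (e ≤ 2 × toℕ (proj₁ (tgt w)) ≡ modℕ m (p + e))

C6 : ∀ {m} → ℕ → Walk m → Set
C6 p P = tgt P ≡ rho 12 (src P) × All (InV1 p) (internals P)

BasicSet2 : (p k : ℕ) → (W X Y Z Q R S T : Walk (p + 12 * k)) → Set
BasicSet2 p k W X Y Z Q R S T =
  (IsDipath W × IsDipath X × IsDipath Y × IsDipath Z
    × IsDipath Q × IsDipath R × IsDipath S × IsDipath T)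
  × (AllPairs Disjoint (Q ∷ R ∷ S ∷ T ∷ [])
    × (1 ≤ k → AllPairs Disjoint (W ∷ X ∷ Y ∷ Z ∷ []))
    × (k ≡ 0 → IsType2Cycle (W ⊙ X) × IsType2Cycle (Y ⊙ Z) × Disjoint (W ⊙ X) (Y ⊙ Z)))
  -- (C2)  ρ^{-p} = ρ^{m-p}
  × (src X ≡ rho (m ∸ p) (tgt W) × src W ≡ rho (m ∸ p) (tgt X)
    × src Z ≡ rho (m ∸ p) (tgt Y) × src Y ≡ rho (m ∸ p) (tgt Z))
  × (len W + len X ≡ p × len Y + len Z ≡ p
    × (1 ≤ k → len Q + len R ≡ 12 × len S + len T ≡ 12)
    × (k ≡ 0 → len Q ≡ 0 × len R ≡ 0 × len S ≡ 0 × len T ≡ 0))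
  × (C4 p W × C4 p X × C4 p Y × C4 p Z)
  × (tgt W ≡ src Q × tgt X ≡ src R × tgt Y ≡ src S × tgt Z ≡ src T)
  × (1 ≤ k → C6 p Q × C6 p R × C6 p S × C6 p T)
  where
  m = p + 12 * k

IsCmFactor : ∀ {m} → List (Walk m) → Set
IsCmFactor {m} cs = All IsDirCycle cs × AllPairs Disjoint cs
  × (∀ (v : Vtx m) → Any (λ c → v ∈ verts c) cs)

module Submission where

-- The pieces of each C^i fit end to end by (C2), (C5) and (C6), since ρ^{-p} = ρ^{12k}, so C^i is
-- a closed walk, of length p + 12k = m by (C3). Arc differences lie in {0, 1, 3}, so while a walk
-- stays in a window of indices narrower than m - 2 no arc wraps around Z_m and the arc sum is the
-- plain difference of the end indices: W and X together sum to 2p and every 12-piece sums to 12,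
-- so C^i is of type 2. The sources and internal vertices of all pieces of C^0 and C^1 are 2m
-- distinct vertices: those of index < p lie on the disjoint dipaths W, X, Y, Z, and the others are
-- translates ρ^{12j}(u), j < k, of vertices u ∈ V_1 of the disjoint dipaths P^i_0, Q^i_0, which fall
-- into the disjoint windows [p + 12j, p + 12j + 12). Hence they exhaust the 2m vertices of G_{2m}.
-- For k = 0 the two cycles are given by (C1).

open import Defs
open import Data.Nat using (ℕ; zero; suc; _+_; _*_; _∸_; _≤_; _<_; _%_; _<?_; z≤n; s≤s; NonZero)
open import Data.Nat.Properties
open import Data.Nat.DivMod using (m%n<n; m%n≤m; m%n%n≡m%n; %-distribˡ-+; [m+n]%n≡m%n; [m+kn]%n≡m%n; m<n⇒m%n≡m)
open import Data.Nat.Tactic.RingSolver using (solve-∀)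
open import Data.Fin using (Fin; toℕ)
import Data.Fin.Properties as Fin
open import Data.Fin.Properties using (toℕ-fromℕ<; toℕ-injective; toℕ<n)
open import Data.Product using (_×_; _,_; proj₁; proj₂; ∃₂; ∃-syntax)
open import Data.Product.Properties using (≡-dec)
open import Data.Sum using (_⊎_; inj₁; inj₂)
open import Data.Empty using (⊥-elim)
open import Function using (_∘_; id)
open import Data.List using (List; []; _∷_; _++_; _∷ʳ_; map; concat; concatMap; filter; length; applyUpTo; allFin)
open import Data.Nat.ListAction using (sum)
open import Data.Nat.ListAction.Properties using (sum-++)
open import Data.List.Properties
  using ( ++-assoc; ++-identityʳ; length-++; length-map; length-++-sucʳ; length-tabulate; map-++; map-id
        ; map-cong; map-applyUpTo; map-upTo; concatMap-++; filter-++; filter-all; filter-none)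
open import Data.List.Relation.Unary.All as All using (All; []; _∷_)
import Data.List.Relation.Unary.All.Properties as All
open import Data.List.Relation.Unary.AllPairs as AllPairs using (AllPairs; []; _∷_)
import Data.List.Relation.Unary.AllPairs.Properties as AllPairs
open import Data.List.Relation.Unary.Linked as Linked using (Linked; _∷_)
import Data.List.Relation.Unary.Linked.Properties as Linked
open import Data.List.Relation.Unary.Unique.Propositional using (Unique)
import Data.List.Relation.Unary.Unique.Propositional.Properties as Unique
import Data.List.Relation.Binary.Disjoint.Propositional as List
open import Data.List.Membership.Propositional using (_∈_)
open import Data.List.Membership.Propositional.Properties
  using (∈-∃++; ∈-++⁺ˡ; ∈-map⁺; ∈-allFin; ∈-++⁺ʳ; ∈-++⁻; ∈-map⁻; ∈-concat⁻′; ∈-applyUpTo⁻; ∈-filter⁺)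
open import Data.List.Relation.Unary.Any using (Any; here; there)
open import Relation.Nullary using (¬_; yes; no; contradiction)
open import Relation.Unary using (Decidable; ∁)
open import Relation.Unary.Properties using (∁?)
open import Relation.Binary.Definitions using (DecidableEquality; tri<; tri≈; tri>)
open import Relation.Binary.PropositionalEquality

-- Arithmetic modulo d

module _ {d : ℕ} .{{_ : NonZero d}} where

  [m%d+n]%d≡[m+n]%d : ∀ m n → (m % d + n) % d ≡ (m + n) % d
  [m%d+n]%d≡[m+n]%d m n = begin
    (m % d + n) % d         ≡⟨ %-distribˡ-+ (m % d) n d ⟩
    (m % d % d + n % d) % d ≡⟨ cong (λ x → (x + n % d) % d) (m%n%n≡m%n m d) ⟩
    (m % d + n % d) % d     ≡⟨ %-distribˡ-+ m n d ⟨
    (m + n) % d             ∎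
    where open ≡-Reasoning

  [m+n%d]%d≡[m+n]%d : ∀ m n → (m + n % d) % d ≡ (m + n) % d
  [m+n%d]%d≡[m+n]%d m n = begin
    (m + n % d) % d ≡⟨ cong (_% d) (+-comm m (n % d)) ⟩
    (n % d + m) % d ≡⟨ [m%d+n]%d≡[m+n]%d n m ⟩
    (n + m) % d     ≡⟨ cong (_% d) (+-comm n m) ⟩
    (m + n) % d     ∎
    where open ≡-Reasoning

  %-cancelˡ-+ : ∀ t m n → (t + m) % d ≡ (t + n) % d → m % d ≡ n % d
  %-cancelˡ-+ t m n eq = begin
    m % d                 ≡⟨ complement m ⟨
    (c + (t + m)) % d     ≡⟨ [m+n%d]%d≡[m+n]%d c (t + m) ⟨
    (c + (t + m) % d) % d ≡⟨ cong (λ x → (c + x) % d) eq ⟩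
    (c + (t + n) % d) % d ≡⟨ [m+n%d]%d≡[m+n]%d c (t + n) ⟩
    (c + (t + n)) % d     ≡⟨ complement n ⟩
    n % d                 ∎
    where
    open ≡-Reasoning
    c : ℕ
    c = t * d ∸ t
    complement : ∀ x → (c + (t + x)) % d ≡ x % d
    complement x = begin
      (c + (t + x)) % d ≡⟨ cong (_% d) (+-assoc c t x) ⟨
      (c + t + x) % d   ≡⟨ cong (λ y → (y + x) % d) (m∸n+n≡m (m≤m*n t d)) ⟩
      (t * d + x) % d   ≡⟨ cong (_% d) (+-comm (t * d) x) ⟩
      (x + t * d) % d   ≡⟨ [m+kn]%n≡m%n x t d ⟩
      x % d             ∎

  lo≤m%d⇒m%d≡m : ∀ {lo x} → x < d + lo → lo ≤ x % d → x % d ≡ x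
  lo≤m%d⇒m%d≡m {lo} {x} x<d+lo lo≤x%d with x <? d
  ... | yes x<d = m<n⇒m%n≡m x<d
  ... | no x≮d = ⊥-elim (<⇒≱ y<lo (≤-trans lo≤x%d (≤-trans (≤-reflexive x%d≡y%d) (m%n≤m y d))))
    where
    y : ℕ
    y = x ∸ d
    x≡y+d : x ≡ y + d
    x≡y+d = sym (m∸n+n≡m (≮⇒≥ x≮d))
    x%d≡y%d : x % d ≡ y % d
    x%d≡y%d = trans (cong (_% d) x≡y+d) ([m+n]%n≡m%n y d)
    y<lo : y < lo
    y<lo = +-cancelʳ-< d y lo (subst₂ _<_ x≡y+d (+-comm d lo) x<d+lo)

-- Stacked windows [lo + c * i, lo + c * (1 + i)) are pairwise disjoint.
window-shift-< : ∀ {lo c a b} i j → a < lo + c → lo ≤ b → i < j → a + c * i < b + c * j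
window-shift-< {lo} {c} {a} {b} i j a<lo+c lo≤b i<j = begin-strict
  a + c * i        <⟨ +-monoˡ-< (c * i) a<lo+c ⟩
  lo + c + c * i   ≡⟨ +-assoc lo c (c * i) ⟩
  lo + (c + c * i) ≡⟨ cong (lo +_) (*-suc c i) ⟨
  lo + c * suc i   ≤⟨ +-mono-≤ lo≤b (*-monoʳ-≤ c i<j) ⟩
  b + c * j        ∎
  where open ≤-Reasoning

window-shift-injective : ∀ {lo c a b} i j → lo ≤ a → a < lo + c → lo ≤ b → b < lo + c →
                         a + c * i ≡ b + c * j → i ≡ j
window-shift-injective i j lo≤a a< lo≤b b< eq with <-cmp i j
... | tri< i<j _ _ = contradiction eq (<⇒≢ (window-shift-< i j a< lo≤b i<j))
... | tri≈ _ i≡j _ = i≡j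
... | tri> _ _ j<i = contradiction (sym eq) (<⇒≢ (window-shift-< j i b< lo≤a j<i))

+-crossed : ∀ {x y a b p} → x + a ≡ p + y → y + b ≡ p + x → a + b ≡ p + p
+-crossed {x} {y} {a} {b} {p} xa yb = +-cancelʳ-≡ (x + y) (a + b) (p + p) (begin
  a + b + (x + y)   ≡⟨ regroupˡ a b x y ⟩
  (x + a) + (y + b) ≡⟨ cong₂ _+_ xa yb ⟩
  (p + y) + (p + x) ≡⟨ regroupʳ p x y ⟩
  p + p + (x + y)   ∎)
  where
  open ≡-Reasoning
  regroupˡ : ∀ a b x y → a + b + (x + y) ≡ (x + a) + (y + b)
  regroupˡ = solve-∀
  regroupʳ : ∀ p x y → (p + y) + (p + x) ≡ p + p + (x + y)
  regroupʳ = solve-∀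

-- Lists

module _ {A : Set} where

  Unique-++⁻ : ∀ (xs : List A) {ys} → Unique (xs ++ ys) → Unique xs × Unique ys × List.Disjoint xs ys
  Unique-++⁻ []       u          = [] , u , λ { (() , _) }
  Unique-++⁻ (x ∷ xs) (x∉ ∷ u) with Unique-++⁻ xs u
  ... | uxs , uys , disj = All.++⁻ˡ xs x∉ ∷ uxs , uys , λ where
    (here refl , x∈ys)  → All.lookup (All.++⁻ʳ xs x∉) x∈ys refl
    (there v∈xs , v∈ys) → disj (v∈xs , v∈ys)

  fresh-filter⁻ : ∀ {P : A → Set} (P? : Decidable P) {x xs} → P x →
                  All (x ≢_) (filter P? xs) → All (x ≢_) xs
  fresh-filter⁻ P? {x} {xs} px x∉ = All.tabulate λ y∈xs x≡y →
    All.lookup x∉ (∈-filter⁺ P? (subst (_∈ xs) (sym x≡y) y∈xs) px) refl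

  -- A repeated element would be repeated on its own side of the partition.
  Unique-partition : ∀ {P : A → Set} (P? : Decidable P) {xs} →
                     Unique (filter P? xs) → Unique (filter (∁? P?) xs) → Unique xs
  Unique-partition P? {[]}     _ _ = []
  Unique-partition P? {x ∷ xs} u u′ with P? x
  ... | yes px with u
  ...   | x∉ ∷ u₁ = fresh-filter⁻ P? px x∉ ∷ Unique-partition P? u₁ u′
  Unique-partition P? {x ∷ xs} u u′ | no ¬px with u′
  ...   | x∉ ∷ u₁′ = fresh-filter⁻ (∁? P?) ¬px x∉ ∷ Unique-partition P? u u₁′

  filter-alternating : ∀ {P : A → Set} (P? : Decidable P) {a b c d} →
                       All P a → All (∁ P) b → All P c → All (∁ P) d →
                       filter P? (a ++ b ++ c ++ d) ≡ a ++ c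
  filter-alternating P? {a} {b} {c} {d} pa pb pc pd
    rewrite filter-++ P? a (b ++ c ++ d) | filter-++ P? b (c ++ d) | filter-++ P? c d
          | filter-all P? pa | filter-none P? pb | filter-all P? pc | filter-none P? pd
          = cong (a ++_) (++-identityʳ c)

  filter-alternating′ : ∀ {P : A → Set} (P? : Decidable P) {a b c d} →
                        All (∁ P) a → All P b → All (∁ P) c → All P d →
                        filter P? (a ++ b ++ c ++ d) ≡ b ++ d
  filter-alternating′ P? {a} {b} {c} {d} pa pb pc pd
    rewrite filter-++ P? a (b ++ c ++ d) | filter-++ P? b (c ++ d) | filter-++ P? c d
          | filter-none P? pa | filter-all P? pb | filter-none P? pc | filter-all P? pd
          = refl

  Unique-interleave : ∀ {P : A → Set} (P? : Decidable P) {a b c d e f g h} →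
    All P a → All (∁ P) b → All P c → All (∁ P) d → All P e → All (∁ P) f → All P g → All (∁ P) h →
    Unique ((a ++ c) ++ (e ++ g)) → Unique ((b ++ d) ++ (f ++ h)) →
    Unique ((a ++ b ++ c ++ d) ++ (e ++ f ++ g ++ h))
  Unique-interleave {P} P? {a} {b} {c} {d} {e} {f} {g} {h} pa pb pc pd pe pf pg ph u u′ =
    Unique-partition P? (subst Unique (sym kept) u) (subst Unique (sym dropped) u′)
    where
    ¬¬ : ∀ {xs} → All P xs → All (∁ (∁ P)) xs
    ¬¬ = All.map (λ px ¬px → ¬px px)
    kept : filter P? ((a ++ b ++ c ++ d) ++ (e ++ f ++ g ++ h)) ≡ (a ++ c) ++ (e ++ g)
    kept = trans (filter-++ P? (a ++ b ++ c ++ d) (e ++ f ++ g ++ h))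
      (cong₂ _++_ (filter-alternating P? pa pb pc pd) (filter-alternating P? pe pf pg ph))
    dropped : filter (∁? P?) ((a ++ b ++ c ++ d) ++ (e ++ f ++ g ++ h)) ≡ (b ++ d) ++ (f ++ h)
    dropped = trans (filter-++ (∁? P?) (a ++ b ++ c ++ d) (e ++ f ++ g ++ h))
      (cong₂ _++_ (filter-alternating′ (∁? P?) (¬¬ pa) pb (¬¬ pc) pd)
                  (filter-alternating′ (∁? P?) (¬¬ pe) pf (¬¬ pg) ph))

  Unique⇒length≤ : ∀ {xs ys : List A} → Unique xs → (∀ {x} → x ∈ xs → x ∈ ys) → length xs ≤ length ys
  Unique⇒length≤ {[]}     _          _    = z≤n
  Unique⇒length≤ {x ∷ xs} (x∉ ∷ uxs) xs⊆ys with ∈-∃++ (xs⊆ys (here refl))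
  ... | ys₁ , ys₂ , refl = begin
    suc (length xs)           ≤⟨ s≤s (Unique⇒length≤ uxs xs⊆ys₁ys₂) ⟩
    suc (length (ys₁ ++ ys₂)) ≡⟨ length-++-sucʳ ys₁ x ys₂ ⟨
    length (ys₁ ++ x ∷ ys₂)   ∎
    where
    open ≤-Reasoning
    xs⊆ys₁ys₂ : ∀ {y} → y ∈ xs → y ∈ ys₁ ++ ys₂
    xs⊆ys₁ys₂ y∈xs with ∈-++⁻ ys₁ (xs⊆ys (there y∈xs))
    ... | inj₁ y∈ys₁        = ∈-++⁺ˡ y∈ys₁
    ... | inj₂ (here refl)  = contradiction refl (All.lookup x∉ y∈xs)
    ... | inj₂ (there y∈ys₂) = ∈-++⁺ʳ ys₁ y∈ys₂

  AllPairs-map-All : ∀ {P : A → Set} {R S : A → A → Set} → (∀ {x y} → P x → P y → R x y → S x y) →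
                     ∀ {xs} → All P xs → AllPairs R xs → AllPairs S xs
  AllPairs-map-All f []         []         = []
  AllPairs-map-All f (px ∷ pxs) (rx ∷ rxs) =
    All.zipWith (λ (r , py) → f px py r) (rx , pxs) ∷ AllPairs-map-All f pxs rxs

concat-four : ∀ {A : Set} (a b c d : List A) → concat (a ∷ b ∷ c ∷ d ∷ []) ≡ (a ++ b) ++ (c ++ d)
concat-four a b c d = trans (cong (λ z → a ++ b ++ c ++ z) (++-identityʳ d)) (sym (++-assoc a b (c ++ d)))

sum-applyUpTo-const : ∀ (f : ℕ → ℕ) n {x} → (∀ i → f i ≡ x) → sum (applyUpTo f n) ≡ n * x
sum-applyUpTo-const f zero    _  = refl
sum-applyUpTo-const f (suc n) fx = cong₂ _+_ (fx 0) (sum-applyUpTo-const (f ∘ suc) n (fx ∘ suc))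

-- Translation and arc differences in G_2m

index : ∀ {m} → Vtx m → ℕ
index v = toℕ (proj₁ v)

InWindow : ∀ {m} → ℕ → ℕ → Vtx m → Set
InWindow lo hi v = lo ≤ index v × index v < hi

module _ {n : ℕ} where
  private
    m : ℕ
    m = suc n

  toℕ-addF : ∀ (a : Fin m) d → toℕ (addF a d) ≡ (toℕ a + d) % m
  toℕ-addF a d = toℕ-fromℕ< _

  index-rho : ∀ j (v : Vtx m) → index (rho j v) ≡ (index v + j) % m
  index-rho j v = toℕ-addF (proj₁ v) j

  index-rho-< : ∀ j (v : Vtx m) → index v + j < m → index (rho j v) ≡ index v + j
  index-rho-< j v lt = trans (index-rho j v) (m<n⇒m%n≡m lt)

  addF-addF : ∀ (a : Fin m) x y → addF (addF a x) y ≡ addF a (x + y)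
  addF-addF a x y = toℕ-injective (begin
    toℕ (addF (addF a x) y)   ≡⟨ toℕ-addF (addF a x) y ⟩
    (toℕ (addF a x) + y) % m  ≡⟨ cong (λ z → (z + y) % m) (toℕ-addF a x) ⟩
    ((toℕ a + x) % m + y) % m ≡⟨ [m%d+n]%d≡[m+n]%d (toℕ a + x) y ⟩
    (toℕ a + x + y) % m       ≡⟨ cong (_% m) (+-assoc (toℕ a) x y) ⟩
    (toℕ a + (x + y)) % m     ≡⟨ toℕ-addF a (x + y) ⟨
    toℕ (addF a (x + y))      ∎)
    where open ≡-Reasoning

  addF-comm : ∀ (a : Fin m) x y → addF (addF a x) y ≡ addF (addF a y) x
  addF-comm a x y = begin
    addF (addF a x) y ≡⟨ addF-addF a x y ⟩
    addF a (x + y)    ≡⟨ cong (addF a) (+-comm x y) ⟩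
    addF a (y + x)    ≡⟨ addF-addF a y x ⟨
    addF (addF a y) x ∎
    where open ≡-Reasoning

  addF-0 : ∀ (a : Fin m) → addF a 0 ≡ a
  addF-0 a = toℕ-injective (trans (toℕ-addF a 0)
    (trans (cong (_% m) (+-identityʳ (toℕ a))) (m<n⇒m%n≡m (toℕ<n a))))

  rho-rho : ∀ i j (v : Vtx m) → rho i (rho j v) ≡ rho (j + i) v
  rho-rho i j (a , s) = cong (_, s) (addF-addF a j i)

  rho-0 : ∀ (v : Vtx m) → rho 0 v ≡ v
  rho-0 (a , s) = cong (_, s) (addF-0 a)

  rho-injective : ∀ j {u v : Vtx m} → rho j u ≡ rho j v → u ≡ v
  rho-injective j {a , s} {b , t} eq = cong₂ _,_ (toℕ-injective (begin
    toℕ a     ≡⟨ m<n⇒m%n≡m (toℕ<n a) ⟨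
    toℕ a % m ≡⟨ %-cancelˡ-+ j (toℕ a) (toℕ b) shifted ⟩
    toℕ b % m ≡⟨ m<n⇒m%n≡m (toℕ<n b) ⟩
    toℕ b     ∎)) (cong proj₂ eq)
    where
    open ≡-Reasoning
    shifted : (j + toℕ a) % m ≡ (j + toℕ b) % m
    shifted = begin
      (j + toℕ a) % m ≡⟨ cong (_% m) (+-comm j (toℕ a)) ⟩
      (toℕ a + j) % m ≡⟨ toℕ-addF a j ⟨
      toℕ (addF a j)  ≡⟨ cong (toℕ ∘ proj₁) eq ⟩
      toℕ (addF b j)  ≡⟨ toℕ-addF b j ⟩
      (toℕ b + j) % m ≡⟨ cong (_% m) (+-comm (toℕ b) j) ⟩
      (j + toℕ b) % m ∎

  rho-arc : ∀ j {u v : Vtx m} → Arc u v → Arc (rho j u) (rho j v)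
  rho-arc j {a , _} (inj₁ refl)                = inj₁ (addF-comm a 1 j)
  rho-arc j {a , _} (inj₂ (inj₁ refl))         = inj₂ (inj₁ (addF-comm a 3 j))
  rho-arc j         (inj₂ (inj₂ (refl , s≢t))) = inj₂ (inj₂ (refl , s≢t))

  diff<m : ∀ (u v : Vtx m) → diff u v < m
  diff<m (a , _) (b , _) = m%n<n (toℕ b + (m ∸ toℕ a)) m

  index-diff : ∀ (u v : Vtx m) → (index u + diff u v) % m ≡ index v
  index-diff (a , _) (b , _) = begin
    (toℕ a + (toℕ b + (m ∸ toℕ a)) % m) % m ≡⟨ [m+n%d]%d≡[m+n]%d (toℕ a) _ ⟩
    (toℕ a + (toℕ b + (m ∸ toℕ a))) % m     ≡⟨ cong (_% m) (+-comm (toℕ a) _) ⟩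
    (toℕ b + (m ∸ toℕ a) + toℕ a) % m       ≡⟨ cong (_% m) (+-assoc (toℕ b) _ _) ⟩
    (toℕ b + (m ∸ toℕ a + toℕ a)) % m       ≡⟨ cong (λ x → (toℕ b + x) % m) (m∸n+n≡m (<⇒≤ (toℕ<n a))) ⟩
    (toℕ b + m) % m                         ≡⟨ [m+n]%n≡m%n (toℕ b) m ⟩
    toℕ b % m                               ≡⟨ m<n⇒m%n≡m (toℕ<n b) ⟩
    toℕ b                                   ∎
    where open ≡-Reasoning

  diff-unique : ∀ (u v : Vtx m) r → r < m → (index u + r) % m ≡ index v → diff u v ≡ r
  diff-unique u v r r<m eq = begin
    diff u v     ≡⟨ m<n⇒m%n≡m (diff<m u v) ⟨
    diff u v % m ≡⟨ %-cancelˡ-+ (index u) (diff u v) r (trans (index-diff u v) (sym eq)) ⟩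
    r % m        ≡⟨ m<n⇒m%n≡m r<m ⟩
    r            ∎
    where open ≡-Reasoning

  diff-rho : ∀ j (u v : Vtx m) → diff (rho j u) (rho j v) ≡ diff u v
  diff-rho j u v = diff-unique (rho j u) (rho j v) (diff u v) (diff<m u v) (begin
    (index (rho j u) + diff u v) % m   ≡⟨ cong (λ x → (x + diff u v) % m) (index-rho j u) ⟩
    ((index u + j) % m + diff u v) % m ≡⟨ [m%d+n]%d≡[m+n]%d (index u + j) (diff u v) ⟩
    (index u + j + diff u v) % m       ≡⟨ cong (_% m) (+-assoc (index u) j (diff u v)) ⟩
    (index u + (j + diff u v)) % m     ≡⟨ cong (λ x → (index u + x) % m) (+-comm j (diff u v)) ⟩
    (index u + (diff u v + j)) % m     ≡⟨ cong (_% m) (+-assoc (index u) (diff u v) j) ⟨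
    (index u + diff u v + j) % m       ≡⟨ [m%d+n]%d≡[m+n]%d (index u + diff u v) j ⟨
    ((index u + diff u v) % m + j) % m ≡⟨ cong (λ x → (x + j) % m) (index-diff u v) ⟩
    (index v + j) % m                  ≡⟨ index-rho j v ⟨
    index (rho j v)                    ∎)
    where open ≡-Reasoning

  diff-addF≤ : ∀ (a : Fin m) s t {d} → diff (a , s) (addF a d , t) ≤ d
  diff-addF≤ a s t {d} = ≤-trans (≤-reflexive (diff-unique (a , s) (addF a d , t) (d % m) (m%n<n d m)
    (trans ([m+n%d]%d≡[m+n]%d (toℕ a) d) (sym (toℕ-addF a d))))) (m%n≤m d m)

  arc-diff≤3 : ∀ {u v : Vtx m} → Arc u v → diff u v ≤ 3
  arc-diff≤3 {a , s} {_ , t} (inj₁ refl)              = ≤-trans (diff-addF≤ a s t) (s≤s z≤n)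
  arc-diff≤3 {a , s} {_ , t} (inj₂ (inj₁ refl))       = diff-addF≤ a s t
  arc-diff≤3 {a , s} {_ , t} (inj₂ (inj₂ (refl , _))) =
    subst (λ b → diff (a , s) (b , t) ≤ 3) (addF-0 a) (≤-trans (diff-addF≤ a s t) z≤n)

-- Walks

module _ {m : ℕ} where

  arcSumW : Walk m → ℕ
  arcSumW w = arcSum (src w) (proj₂ w)

  initVs : List (Walk m) → List (Vtx m)
  initVs = concatMap initV

  lastV-++ : ∀ (v : Vtx m) vs us → lastV v (vs ++ us) ≡ lastV (lastV v vs) us
  lastV-++ v []       us = refl
  lastV-++ v (u ∷ vs) us = lastV-++ u vs us

  initL-++ : ∀ (v : Vtx m) vs us → initL v (vs ++ us) ≡ initL v vs ++ initL (lastV v vs) us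
  initL-++ v []       us = refl
  initL-++ v (u ∷ vs) us = cong (v ∷_) (initL-++ u vs us)

  arcSum-++ : ∀ (v : Vtx m) vs us → arcSum v (vs ++ us) ≡ arcSum v vs + arcSum (lastV v vs) us
  arcSum-++ v []       us = refl
  arcSum-++ v (u ∷ vs) us = trans (cong (diff v u +_) (arcSum-++ u vs us)) (sym (+-assoc (diff v u) _ _))

  Linked-++ : ∀ (v : Vtx m) vs us → Linked Arc (v ∷ vs) → Linked Arc (lastV v vs ∷ us) →
              Linked Arc (v ∷ vs ++ us)
  Linked-++ v []       us _            walk′ = walk′
  Linked-++ v (u ∷ vs) us (arc ∷ walk) walk′ = arc ∷ Linked-++ u vs us walk walk′

  initL-∷ʳ-lastV : ∀ (v : Vtx m) vs → initL v vs ∷ʳ lastV v vs ≡ v ∷ vs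
  initL-∷ʳ-lastV v []       = refl
  initL-∷ʳ-lastV v (u ∷ vs) = cong (v ∷_) (initL-∷ʳ-lastV u vs)

  lastV-map : ∀ (f : Vtx m → Vtx m) v vs → lastV (f v) (map f vs) ≡ f (lastV v vs)
  lastV-map f v []       = refl
  lastV-map f v (u ∷ vs) = lastV-map f u vs

  initL-map : ∀ (f : Vtx m → Vtx m) v vs → initL (f v) (map f vs) ≡ map f (initL v vs)
  initL-map f v []       = refl
  initL-map f v (u ∷ vs) = cong (f v ∷_) (initL-map f u vs)

  initV⊆verts : ∀ (w : Walk m) {x} → x ∈ initV w → x ∈ verts w
  initV⊆verts (v , vs) x∈ = subst (_ ∈_) (initL-∷ʳ-lastV v vs) (∈-++⁺ˡ x∈)

  initV-disjoint : ∀ {w w′ : Walk m} → Disjoint w w′ → List.Disjoint (initV w) (initV w′)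
  initV-disjoint {w} {w′} disj (x∈ , x∈′) = disj _ (initV⊆verts w x∈) (initV⊆verts w′ x∈′)

  initV-unique : ∀ (w : Walk m) → Unique (verts w) → Unique (initV w)
  initV-unique (v , vs) u = proj₁ (Unique-++⁻ (initL v vs) (subst Unique (sym (initL-∷ʳ-lastV v vs)) u))

  initVs-unique : ∀ (ws : List (Walk m)) → All (Unique ∘ verts) ws → AllPairs Disjoint ws → Unique (initVs ws)
  initVs-unique ws us disj = Unique.concat⁺ (All.map⁺ (All.map (λ {w} → initV-unique w) us))
    (AllPairs.map⁺ (AllPairs.map initV-disjoint disj))

  All-initV : ∀ {P : Vtx m → Set} (w : Walk m) → P (src w) → All P (internals w) → All P (initV w)
  All-initV (v , [])     _  _   = []
  All-initV (v , u ∷ us) pv pus = pv ∷ pus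

  closed-tail-unique : ∀ (w : Walk m) → tgt w ≡ src w → Unique (initV w) → Unique (proj₂ w)
  closed-tail-unique (v , [])     _      _              = []
  closed-tail-unique (v , u ∷ us) closed (v∉ ∷ uinit) =
    subst Unique (trans (cong (initL u us ∷ʳ_) (sym closed)) (initL-∷ʳ-lastV u us))
      (Unique.++⁺ uinit ([] ∷ []) λ { (x∈ , here refl) → All.lookup v∉ x∈ refl })

  closed-∈-initV : ∀ (w : Walk m) {x} → tgt w ≡ src w → 0 < len w → x ∈ verts w → x ∈ initV w
  closed-∈-initV (v , u ∷ us)     closed _ (here refl) = here refl
  closed-∈-initV (v , u ∷ us) {x} closed _ (there x∈)
    with ∈-++⁻ (initL u us) (subst (x ∈_) (sym (initL-∷ʳ-lastV u us)) x∈)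
  ... | inj₁ x∈init      = there x∈init
  ... | inj₂ (here refl) = here closed

  closed-walk-cycle : ∀ (w : Walk m) → IsWalk w → tgt w ≡ src w → len w ≡ m →
                      Unique (initV w) → IsDirCycle w
  closed-walk-cycle w walk closed len≡m u = walk , closed , len≡m , closed-tail-unique w closed u

  Chain : Vtx m → List (Walk m) → Vtx m → Set
  Chain u []       v = u ≡ v
  Chain u (w ∷ ws) v = u ≡ src w × Chain (tgt w) ws v

  Chain-++ : ∀ {u v x} ws {ws′} → Chain u ws v → Chain v ws′ x → Chain u (ws ++ ws′) x
  Chain-++ []       refl     c′ = c′
  Chain-++ (w ∷ ws) (e , c) c′ = e , Chain-++ ws c c′

  Chain-applyUpTo : ∀ (f : ℕ → Walk m) c → (∀ j → tgt (f j) ≡ src (f (suc j))) →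
                    Chain (src (f 0)) (applyUpTo f c) (src (f c))
  Chain-applyUpTo f zero    _    = refl
  Chain-applyUpTo f (suc c) link =
    refl , subst (λ z → Chain z (applyUpTo (f ∘ suc) c) (src (f (suc c)))) (sym (link 0))
                 (Chain-applyUpTo (f ∘ suc) c (link ∘ suc))

  tgt-⊙ : ∀ (w w′ : Walk m) → tgt w ≡ src w′ → tgt (w ⊙ w′) ≡ tgt w′
  tgt-⊙ (v , vs) (u , us) e = trans (lastV-++ v vs us) (cong (λ z → lastV z us) e)

  initV-⊙ : ∀ (w w′ : Walk m) → tgt w ≡ src w′ → initV (w ⊙ w′) ≡ initV w ++ initV w′
  initV-⊙ (v , vs) (u , us) e = trans (initL-++ v vs us) (cong (λ z → initL v vs ++ initL z us) e)

  arcSumW-⊙ : ∀ (w w′ : Walk m) → tgt w ≡ src w′ → arcSumW (w ⊙ w′) ≡ arcSumW w + arcSumW w′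
  arcSumW-⊙ (v , vs) (u , us) e = trans (arcSum-++ v vs us) (cong (λ z → arcSum v vs + arcSum z us) e)

  ⊙-walk : ∀ (w w′ : Walk m) → tgt w ≡ src w′ → IsWalk w → IsWalk w′ → IsWalk (w ⊙ w′)
  ⊙-walk (v , vs) (u , us) e walk walk′ = Linked-++ v vs us walk (subst (λ z → Linked Arc (z ∷ us)) (sym e) walk′)

  Chain-⊙ : ∀ (w w′ : Walk m) {ws v} → tgt w ≡ src w′ → Chain (tgt w′) ws v → Chain (tgt (w ⊙ w′)) ws v
  Chain-⊙ w w′ {ws} {v} e = subst (λ z → Chain z ws v) (sym (tgt-⊙ w w′ e))

  src-concatW : ∀ (w : Walk m) ws → src (concatW w ws) ≡ src w
  src-concatW w []        = refl
  src-concatW w (w′ ∷ ws) = src-concatW (w ⊙ w′) ws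

  tgt-concatW : ∀ w ws {v} → Chain (tgt w) ws v → tgt (concatW w ws) ≡ v
  tgt-concatW w []        c       = c
  tgt-concatW w (w′ ∷ ws) (e , c) = tgt-concatW (w ⊙ w′) ws (Chain-⊙ w w′ e c)

  initV-concatW : ∀ w ws {v} → Chain (tgt w) ws v → initV (concatW w ws) ≡ initV w ++ initVs ws
  initV-concatW w []        _       = sym (++-identityʳ (initV w))
  initV-concatW w (w′ ∷ ws) (e , c) = begin
    initV (concatW (w ⊙ w′) ws)        ≡⟨ initV-concatW (w ⊙ w′) ws (Chain-⊙ w w′ e c) ⟩
    initV (w ⊙ w′) ++ initVs ws        ≡⟨ cong (_++ initVs ws) (initV-⊙ w w′ e) ⟩
    (initV w ++ initV w′) ++ initVs ws ≡⟨ ++-assoc (initV w) (initV w′) (initVs ws) ⟩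
    initV w ++ initVs (w′ ∷ ws)        ∎
    where open ≡-Reasoning

  arcSumW-concatW : ∀ w ws {v} → Chain (tgt w) ws v → arcSumW (concatW w ws) ≡ arcSumW w + sum (map arcSumW ws)
  arcSumW-concatW w []        _       = sym (+-identityʳ (arcSumW w))
  arcSumW-concatW w (w′ ∷ ws) (e , c) = begin
    arcSumW (concatW (w ⊙ w′) ws)                   ≡⟨ arcSumW-concatW (w ⊙ w′) ws (Chain-⊙ w w′ e c) ⟩
    arcSumW (w ⊙ w′) + sum (map arcSumW ws)         ≡⟨ cong (_+ sum (map arcSumW ws)) (arcSumW-⊙ w w′ e) ⟩
    arcSumW w + arcSumW w′ + sum (map arcSumW ws)   ≡⟨ +-assoc (arcSumW w) (arcSumW w′) _ ⟩
    arcSumW w + sum (map arcSumW (w′ ∷ ws))         ∎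
    where open ≡-Reasoning

  len-concatW : ∀ (w : Walk m) ws → len (concatW w ws) ≡ len w + sum (map len ws)
  len-concatW w []        = sym (+-identityʳ (len w))
  len-concatW w (w′ ∷ ws) = begin
    len (concatW (w ⊙ w′) ws)           ≡⟨ len-concatW (w ⊙ w′) ws ⟩
    len (w ⊙ w′) + sum (map len ws)     ≡⟨ cong (_+ sum (map len ws)) (length-++ (proj₂ w)) ⟩
    len w + len w′ + sum (map len ws)   ≡⟨ +-assoc (len w) (len w′) _ ⟩
    len w + sum (map len (w′ ∷ ws))     ∎
    where open ≡-Reasoning

  concatW-walk : ∀ w ws {v} → Chain (tgt w) ws v → IsWalk w → All IsWalk ws → IsWalk (concatW w ws)
  concatW-walk w []        _       walk _               = walk
  concatW-walk w (w′ ∷ ws) (e , c) walk (walk′ ∷ walks) =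
    concatW-walk (w ⊙ w′) ws (Chain-⊙ w w′ e c) (⊙-walk w w′ e walk walk′) walks

  tgt-shiftW : ∀ j (w : Walk m) → tgt (shiftW j w) ≡ rho j (tgt w)
  tgt-shiftW j (v , vs) = lastV-map (rho j) v vs

  initV-shiftW : ∀ j (w : Walk m) → initV (shiftW j w) ≡ map (rho j) (initV w)
  initV-shiftW j (v , vs) = initL-map (rho j) v vs

  len-shiftW : ∀ j (w : Walk m) → len (shiftW j w) ≡ len w
  len-shiftW j (v , vs) = length-map (rho j) vs

-- C_m-factors

_≟ˢ_ : DecidableEquality Side
xS ≟ˢ xS = yes refl
xS ≟ˢ yS = no λ ()
yS ≟ˢ xS = no λ ()
yS ≟ˢ yS = yes refl

module _ {m : ℕ} where

  _≟ⱽ_ : DecidableEquality (Vtx m)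
  _≟ⱽ_ = ≡-dec Fin._≟_ _≟ˢ_

  open import Data.List.Membership.DecPropositional _≟ⱽ_ using (_∈?_)

  allVertices : List (Vtx m)
  allVertices = map (_, xS) (allFin m) ++ map (_, yS) (allFin m)

  ∈-allVertices : ∀ v → v ∈ allVertices
  ∈-allVertices (a , xS) = ∈-++⁺ˡ (∈-map⁺ (_, xS) (∈-allFin a))
  ∈-allVertices (a , yS) = ∈-++⁺ʳ (map (_, xS) (allFin m)) (∈-map⁺ (_, yS) (∈-allFin a))

  length-allVertices : length allVertices ≡ m + m
  length-allVertices = trans (length-++ (map (_, xS) (allFin m))) (cong₂ _+_ (one-side xS) (one-side yS))
    where
    one-side : ∀ s → length (map (_, s) (allFin m)) ≡ m
    one-side s = trans (length-map (_, s) (allFin m)) (length-tabulate id)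

  Unique-complete : ∀ {vs : List (Vtx m)} → Unique vs → length vs ≡ m + m → ∀ v → v ∈ vs
  Unique-complete {vs} u len≡ v with v ∈? vs
  ... | yes v∈vs = v∈vs
  ... | no v∉vs  = contradiction (subst₂ _≤_ (cong suc len≡) length-allVertices
                    (Unique⇒length≤ (fresh ∷ u) (λ {x} _ → ∈-allVertices x))) 1+n≰n
    where
    fresh : All (v ≢_) vs
    fresh = All.tabulate λ x∈vs v≡x → v∉vs (subst (_∈ vs) (sym v≡x) x∈vs)

  two-cycles-factor : ∀ {c d : Walk m} → IsDirCycle c → IsDirCycle d → Disjoint c d → IsCmFactor (c ∷ d ∷ [])
  two-cycles-factor {c} {d} cyc-c@(_ , _ , len-c , u-c) cyc-d@(_ , _ , len-d , u-d) disj =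
    (cyc-c ∷ cyc-d ∷ []) , ((disj ∷ []) ∷ [] ∷ []) , covered
    where
    tails-unique : Unique (proj₂ c ++ proj₂ d)
    tails-unique = Unique.++⁺ u-c u-d λ (x∈c , x∈d) → disj _ (there x∈c) (there x∈d)
    tails-length : length (proj₂ c ++ proj₂ d) ≡ m + m
    tails-length = trans (length-++ (proj₂ c)) (cong₂ _+_ len-c len-d)
    covered : ∀ v → Any (λ w → v ∈ verts w) (c ∷ d ∷ [])
    covered v with ∈-++⁻ (proj₂ c) (Unique-complete tails-unique tails-length v)
    ... | inj₁ v∈c = here (there v∈c)
    ... | inj₂ v∈d = there (here (there v∈d))

module _ {n : ℕ} where
  private
    m : ℕ
    m = suc n

  closed-walks-factor : ∀ (c d : Walk m) → IsWalk c → IsWalk d → tgt c ≡ src c → tgt d ≡ src d →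
    len c ≡ m → len d ≡ m → arcSumW c ≡ 2 * m → arcSumW d ≡ 2 * m → Unique (initV c ++ initV d) →
    IsType2Cycle c × IsType2Cycle d × IsCmFactor (c ∷ d ∷ [])
  closed-walks-factor c d walk-c walk-d closed-c closed-d len-c len-d arcs-c arcs-d u
    with Unique-++⁻ (initV c) u
  ... | u-c , u-d , disj = (cyc-c , arcs-c) , (cyc-d , arcs-d) , two-cycles-factor cyc-c cyc-d disjoint
    where
    cyc-c : IsDirCycle c
    cyc-c = closed-walk-cycle c walk-c closed-c len-c u-c
    cyc-d : IsDirCycle d
    cyc-d = closed-walk-cycle d walk-d closed-d len-d u-d
    disjoint : Disjoint c d
    disjoint x x∈c x∈d = disj (closed-∈-initV c closed-c (subst (0 <_) (sym len-c) (s≤s z≤n)) x∈c ,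
                               closed-∈-initV d closed-d (subst (0 <_) (sym len-d) (s≤s z≤n)) x∈d)

-- Translates of walks and arc sums inside a window

module _ {n : ℕ} where
  private
    m : ℕ
    m = suc n

  arcSum-rho : ∀ j (v : Vtx m) vs → arcSum (rho j v) (map (rho j) vs) ≡ arcSum v vs
  arcSum-rho j v []       = refl
  arcSum-rho j v (u ∷ us) = cong₂ _+_ (diff-rho j v u) (arcSum-rho j u us)

  arcSumW-shiftW : ∀ j (w : Walk m) → arcSumW (shiftW j w) ≡ arcSumW w
  arcSumW-shiftW j (v , vs) = arcSum-rho j v vs

  shiftW-walk : ∀ j (w : Walk m) → IsWalk w → IsWalk (shiftW j w)
  shiftW-walk j w walk = Linked.map⁺ (Linked.map (rho-arc j) walk)

  shiftW-0 : ∀ (w : Walk m) → shiftW 0 w ≡ w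
  shiftW-0 (v , vs) = cong₂ _,_ (rho-0 v) (trans (map-cong rho-0 vs) (map-id vs))

  pieces≡applyUpTo : ∀ k (P : Walk m) → pieces k P ≡ applyUpTo (λ j → shiftW (12 * j) P) k
  pieces≡applyUpTo zero    P = refl
  pieces≡applyUpTo (suc k) P = cong₂ _∷_ (sym (shiftW-0 P)) (map-upTo (λ j → shiftW (12 * suc j) P) k)

  pieces-walk : ∀ k (P : Walk m) → IsWalk P → All IsWalk (pieces k P)
  pieces-walk k P walk = subst (All IsWalk) (sym (pieces≡applyUpTo k P))
    (All.applyUpTo⁺₂ (λ j → shiftW (12 * j) P) k (λ j → shiftW-walk (12 * j) P walk))

  sum-map-pieces : ∀ k (P : Walk m) (f : Walk m → ℕ) → (∀ j → f (shiftW j P) ≡ f P) →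
                   sum (map f (pieces k P)) ≡ k * f P
  sum-map-pieces k P f invariant = begin
    sum (map f (pieces k P))                               ≡⟨ cong (sum ∘ map f) (pieces≡applyUpTo k P) ⟩
    sum (map f (applyUpTo (λ j → shiftW (12 * j) P) k))    ≡⟨ cong sum (map-applyUpTo _ f k) ⟩
    sum (applyUpTo (λ j → f (shiftW (12 * j) P)) k)        ≡⟨ sum-applyUpTo-const _ k (λ j → invariant (12 * j)) ⟩
    k * f P                                                ∎
    where open ≡-Reasoning

  pieces-Chain : ∀ k (P : Walk m) → tgt P ≡ rho 12 (src P) → Chain (src P) (pieces k P) (rho (12 * k) (src P))
  pieces-Chain k P closes = subst₂ (λ u ws → Chain u ws (rho (12 * k) (src P)))
    (rho-0 (src P)) (sym (pieces≡applyUpTo k P)) (Chain-applyUpTo (λ j → shiftW (12 * j) P) k link)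
    where
    open ≡-Reasoning
    link : ∀ j → tgt (shiftW (12 * j) P) ≡ rho (12 * suc j) (src P)
    link j = begin
      tgt (shiftW (12 * j) P)       ≡⟨ tgt-shiftW (12 * j) P ⟩
      rho (12 * j) (tgt P)          ≡⟨ cong (rho (12 * j)) closes ⟩
      rho (12 * j) (rho 12 (src P)) ≡⟨ rho-rho (12 * j) 12 (src P) ⟩
      rho (12 + 12 * j) (src P)     ≡⟨ cong (λ i → rho i (src P)) (*-suc 12 j) ⟨
      rho (12 * suc j) (src P)      ∎

  ∈-initVs-pieces⁻ : ∀ k (P : Walk m) {x} → x ∈ initVs (pieces k P) →
                     ∃₂ λ j u → j < k × u ∈ initV P × x ≡ rho (12 * j) u
  ∈-initVs-pieces⁻ k P {x} x∈ with ∈-concat⁻′ (map initV (pieces k P)) x∈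
  ... | xs , x∈xs , xs∈ with ∈-map⁻ initV xs∈
  ... | w , w∈ , refl with ∈-applyUpTo⁻ (λ j → shiftW (12 * j) P) (subst (w ∈_) (pieces≡applyUpTo k P) w∈)
  ... | j , j<k , refl with ∈-map⁻ (rho (12 * j)) (subst (x ∈_) (initV-shiftW (12 * j) P) x∈xs)
  ... | u , u∈ , x≡ = j , u , j<k , u∈ , x≡

  index-lastV : ∀ (v : Vtx m) vs → (index v + arcSum v vs) % m ≡ index (lastV v vs)
  index-lastV v []       = trans (cong (_% m) (+-identityʳ (index v))) (m<n⇒m%n≡m (toℕ<n (proj₁ v)))
  index-lastV v (u ∷ us) = begin
    (index v + (diff v u + arcSum u us)) % m     ≡⟨ cong (_% m) (+-assoc (index v) (diff v u) _) ⟨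
    (index v + diff v u + arcSum u us) % m       ≡⟨ [m%d+n]%d≡[m+n]%d (index v + diff v u) _ ⟨
    ((index v + diff v u) % m + arcSum u us) % m ≡⟨ cong (λ x → (x + arcSum u us) % m) (index-diff v u) ⟩
    (index u + arcSum u us) % m                  ≡⟨ index-lastV u us ⟩
    index (lastV u us)                           ∎
    where open ≡-Reasoning

  -- While a walk stays in a window of width < m - 2, no arc wraps around Z_m.
  arcSum-window : ∀ {lo hi} → hi + 3 ≤ m + lo → ∀ (v : Vtx m) vs → Linked Arc (v ∷ vs) →
                  All (InWindow lo hi) (initL v vs) → index v < hi + 3 → index v + arcSum v vs < hi + 3
  arcSum-window {hi = hi} wide v [] _ _ v< = subst (_< hi + 3) (sym (+-identityʳ (index v))) v<
  arcSum-window {hi = hi} wide v (u ∷ []) (arc ∷ _) ((_ , v<hi) ∷ []) _ =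
    subst (_< hi + 3) (cong (index v +_) (sym (+-identityʳ (diff v u)))) (+-mono-<-≤ v<hi (arc-diff≤3 arc))
  arcSum-window {lo} {hi} wide v (u ∷ w ∷ ws) (arc ∷ walk) ((_ , v<hi) ∷ inW@((lo≤u , u<hi) ∷ _)) _ =
    subst (_< hi + 3) (trans (cong (_+ arcSum u (w ∷ ws)) u≡) (+-assoc (index v) (diff v u) _))
      (arcSum-window wide u (w ∷ ws) walk inW (≤-trans u<hi (m≤m+n hi 3)))
    where
    step< : index v + diff v u < hi + 3
    step< = +-mono-<-≤ v<hi (arc-diff≤3 arc)
    u≡ : index u ≡ index v + diff v u
    u≡ = trans (sym (index-diff v u))
      (lo≤m%d⇒m%d≡m (<-≤-trans step< wide) (subst (lo ≤_) (sym (index-diff v u)) lo≤u))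

  arcSumW-exact : ∀ {lo hi} (w : Walk m) → hi + 3 ≤ m → IsWalk w → All (InWindow lo hi) (initV w) →
                  index (src w) < hi + 3 → index (src w) + arcSumW w ≡ index (tgt w)
  arcSumW-exact {lo} {hi} (v , vs) fits walk inW v< = begin
    index v + arcSum v vs       ≡⟨ m<n⇒m%n≡m (<-≤-trans bound fits) ⟨
    (index v + arcSum v vs) % m ≡⟨ index-lastV v vs ⟩
    index (lastV v vs)          ∎
    where
    open ≡-Reasoning
    bound : index v + arcSum v vs < hi + 3
    bound = arcSum-window (≤-trans fits (m≤m+n m lo)) v vs walk inW v<

  -- The arc sum is ≡ c modulo m and, by arcSum-window, less than c + 3 ≤ m.
  arcSumW-translate : ∀ {lo} c (w : Walk m) → c + 3 ≤ m → IsWalk w → InWindow lo (lo + c) (src w) →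
                      All (InWindow lo (lo + c)) (initV w) → tgt w ≡ rho c (src w) → arcSumW w ≡ c
  arcSumW-translate {lo} c (v , vs) c+3≤m walk (lo≤v , v<) inW closes = begin
    a     ≡⟨ m<n⇒m%n≡m a<m ⟨
    a % m ≡⟨ %-cancelˡ-+ (index v) a c (trans (index-lastV v vs) (trans (cong index closes) (index-rho c v))) ⟩
    c % m ≡⟨ m<n⇒m%n≡m (<-≤-trans (m<m+n c (s≤s z≤n)) c+3≤m) ⟩
    c     ∎
    where
    open ≡-Reasoning
    a : ℕ
    a = arcSum v vs
    wide : lo + c + 3 ≤ m + lo
    wide = subst (_≤ m + lo) (sym (+-assoc lo c 3)) (subst (lo + (c + 3) ≤_) (+-comm lo m) (+-monoʳ-≤ lo c+3≤m))
    bound : index v + a < lo + c + 3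
    bound = arcSum-window wide v vs walk inW (≤-trans v< (m≤m+n (lo + c) 3))
    a<m : a < m
    a<m = <-≤-trans (+-cancelˡ-< (index v) a (c + 3) (<-≤-trans bound
            (subst (_≤ index v + (c + 3)) (sym (+-assoc lo c 3)) (+-monoˡ-≤ (c + 3) lo≤v)))) c+3≤m

-- Type-2 basic sets with k ≥ 1

module _ (p′ k′ : ℕ) (2≤p′ : 2 ≤ p′) where
  private
    p k m : ℕ
    p = suc p′
    k = suc k′
    m = p + 12 * k

    12≤12k : 12 ≤ 12 * k
    12≤12k = m≤m*n 12 k

    15≤m : 15 ≤ m
    15≤m = +-mono-≤ (s≤s 2≤p′) 12≤12k

    p+3≤m : p + 3 ≤ m
    p+3≤m = +-monoʳ-≤ p (≤-trans (m≤m+n 3 9) 12≤12k)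

    m∸p≡12k : m ∸ p ≡ 12 * k
    m∸p≡12k = m+n∸m≡n p (12 * k)

  C4-tgt : ∀ {A : Walk m} → C4 p A → ∃[ e ] (e ≤ 2 × index (tgt A) ≡ p + e)
  C4-tgt (_ , e , e≤2 , eq) = e , e≤2 , trans eq (m<n⇒m%n≡m (<-≤-trans (+-monoʳ-< p (s≤s e≤2)) p+3≤m))

  index-rho-m∸p : ∀ (v : Vtx m) {e} → e ≤ 2 → index v ≡ p + e → index (rho (m ∸ p) v) ≡ e
  index-rho-m∸p v {e} e≤2 iv = begin
    index (rho (m ∸ p) v)   ≡⟨ index-rho (m ∸ p) v ⟩
    (index v + (m ∸ p)) % m ≡⟨ cong₂ (λ x y → (x + y) % m) iv m∸p≡12k ⟩
    (p + e + 12 * k) % m    ≡⟨ cong (_% m) (wrap p e (12 * k)) ⟩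
    (e + m) % m             ≡⟨ [m+n]%n≡m%n e m ⟩
    e % m                   ≡⟨ m<n⇒m%n≡m (<-≤-trans (s≤s e≤2) (≤-trans (m≤m+n 3 12) 15≤m)) ⟩
    e                       ∎
    where
    open ≡-Reasoning
    wrap : ∀ p e c → p + e + c ≡ e + (p + c)
    wrap = solve-∀

  near-p-in-V1 : ∀ (v : Vtx m) {e} → e ≤ 2 → index v ≡ p + e → InV1 p v
  near-p-in-V1 v {e} e≤2 iv =
    subst (p ≤_) (sym iv) (m≤m+n p e) , subst (_< p + 12) (sym iv) (+-monoʳ-< p (≤-trans (s≤s e≤2) (m≤m+n 3 9)))

  layer0-arcSumW : ∀ (A : Walk m) → IsWalk A → C4 p A → index (src A) ≤ 2 →
                   index (src A) + arcSumW A ≡ index (tgt A)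
  layer0-arcSumW A walk (inV0 , _) src≤2 =
    arcSumW-exact {lo = 0} A p+3≤m walk (All.map (z≤n ,_) inV0) (≤-<-trans src≤2 (m≤n+m 3 p))

  -- InV1 p is InWindow p (p + 12) by definition.
  piece-arcSumW : ∀ (P : Walk m) → IsWalk P → C6 p P → InV1 p (src P) → arcSumW P ≡ 12
  piece-arcSumW P walk (closes , inV1) src∈V1 =
    arcSumW-translate 12 P 15≤m walk src∈V1 (All-initV P src∈V1 inV1) closes

  index-translate : ∀ (u : Vtx m) {j} → InV1 p u → j < k → index (rho (12 * j) u) ≡ index u + 12 * j
  index-translate u {j} (_ , u<) j<k = index-rho-< (12 * j) u (window-shift-< {lo = p} {c = 12} j k u< ≤-refl j<k)

  translate-injective : ∀ i j (u u′ : Vtx m) → InV1 p u → InV1 p u′ → i < k → j < k →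
                        rho (12 * i) u ≡ rho (12 * j) u′ → i ≡ j × u ≡ u′
  translate-injective i j u u′ u∈@(p≤u , u<) u′∈@(p≤u′ , u′<) i<k j<k eq =
    i≡j , rho-injective (12 * j) (subst (λ l → rho (12 * l) u ≡ rho (12 * j) u′) i≡j eq)
    where
    i≡j : i ≡ j
    i≡j = window-shift-injective {lo = p} {c = 12} i j p≤u u< p≤u′ u′<
      (trans (sym (index-translate u u∈ i<k)) (trans (cong index eq) (index-translate u′ u′∈ j<k)))

  initVs-pieces-above-V0 : ∀ (P : Walk m) → All (InV1 p) (initV P) → All (∁ (InV0 p)) (initVs (pieces k P))
  initVs-pieces-above-V0 P inV1 = All.tabulate above
    where
    above : ∀ {x} → x ∈ initVs (pieces k P) → ¬ InV0 p x
    above x∈ with ∈-initVs-pieces⁻ k P x∈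
    ... | j , u , j<k , u∈ , refl = ≤⇒≯ (≤-trans (proj₁ (All.lookup inV1 u∈))
      (subst (index u ≤_) (sym (index-translate u (All.lookup inV1 u∈) j<k)) (m≤m+n (index u) (12 * j))))

  initVs-pieces-unique : ∀ (P : Walk m) → All (InV1 p) (initV P) → Unique (initV P) →
                         Unique (initVs (pieces k P))
  initVs-pieces-unique P inV1 uP = subst Unique (sym blocks)
    (Unique.concat⁺ (All.applyUpTo⁺₁ block k block-unique) (AllPairs.applyUpTo⁺₁ block k blocks-disjoint))
    where
    block : ℕ → List (Vtx m)
    block j = initV (shiftW (12 * j) P)
    blocks : initVs (pieces k P) ≡ concat (applyUpTo block k)
    blocks = cong concat (trans (cong (map initV) (pieces≡applyUpTo k P))
                                (map-applyUpTo (λ j → shiftW (12 * j) P) initV k))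
    block-unique : ∀ {j} → j < k → Unique (block j)
    block-unique {j} _ = subst Unique (sym (initV-shiftW (12 * j) P)) (Unique.map⁺ (rho-injective (12 * j)) uP)
    blocks-disjoint : ∀ {i j} → i < j → j < k → List.Disjoint (block i) (block j)
    blocks-disjoint {i} {j} i<j j<k {x} (x∈i , x∈j)
      with ∈-map⁻ (rho (12 * i)) (subst (x ∈_) (initV-shiftW (12 * i) P) x∈i)
         | ∈-map⁻ (rho (12 * j)) (subst (x ∈_) (initV-shiftW (12 * j) P) x∈j)
    ... | u , u∈ , refl | u′ , u′∈ , eq = <⇒≢ i<j (proj₁
      (translate-injective i j u u′ (All.lookup inV1 u∈) (All.lookup inV1 u′∈) (<-trans i<j j<k) j<k eq))

  initVs-pieces-disjoint : ∀ {P R : Walk m} → All (InV1 p) (initV P) → All (InV1 p) (initV R) →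
                           Disjoint P R → List.Disjoint (initVs (pieces k P)) (initVs (pieces k R))
  initVs-pieces-disjoint {P} {R} inP inR disj (x∈P , x∈R) =
    let i , u , i<k , u∈ , x≡ = ∈-initVs-pieces⁻ k P x∈P
        j , u′ , j<k , u′∈ , x≡′ = ∈-initVs-pieces⁻ k R x∈R
        _ , u≡u′ = translate-injective i j u u′ (All.lookup inP u∈) (All.lookup inR u′∈) i<k j<k
                                       (trans (sym x≡) x≡′)
    in disj u (initV⊆verts P u∈) (subst (_∈ verts R) (sym u≡u′) (initV⊆verts R u′∈))

  initVs-translates-unique : ∀ (Ps : List (Walk m)) → All (λ P → All (InV1 p) (initV P)) Ps →
    All (Unique ∘ verts) Ps → AllPairs Disjoint Ps → Unique (concatMap (initVs ∘ pieces k) Ps)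
  initVs-translates-unique Ps inV1 us disj = Unique.concat⁺
    (All.map⁺ (All.zipWith (λ {P} (inP , uP) → initVs-pieces-unique P inP (initV-unique P uP)) (inV1 , us)))
    (AllPairs.map⁺ (AllPairs-map-All initVs-pieces-disjoint inV1 disj))

  pieces-bridge : ∀ {P : Walk m} {u v} → C6 p P → u ≡ src P → rho (m ∸ p) u ≡ v → Chain u (pieces k P) v
  pieces-bridge {P} (closes , _) refl eq =
    subst (Chain (src P) (pieces k P)) (trans (cong (λ j → rho j (src P)) (sym m∸p≡12k)) eq) (pieces-Chain k P closes)

  module HalfBasicSet (A B P R : Walk m)
    (walkA : IsWalk A) (walkB : IsWalk B) (walkP : IsWalk P) (walkR : IsWalk R)
    (B-after-A : src B ≡ rho (m ∸ p) (tgt A)) (A-after-B : src A ≡ rho (m ∸ p) (tgt B))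
    (lenAB : len A + len B ≡ p) (lenPR : len P + len R ≡ 12)
    (c4A : C4 p A) (c4B : C4 p B) (A→P : tgt A ≡ src P) (B→R : tgt B ≡ src R)
    (c6P : C6 p P) (c6R : C6 p R) where

    private
      parts : List (Walk m)
      parts = pieces k P ++ B ∷ pieces k R

      chain : Chain (tgt A) parts (src A)
      chain = Chain-++ (pieces k P) (pieces-bridge c6P A→P (sym B-after-A))
                                   (refl , pieces-bridge c6R B→R (sym A-after-B))

      sum-parts : ∀ (f : Walk m → ℕ) → (∀ j → f (shiftW j P) ≡ f P) → (∀ j → f (shiftW j R) ≡ f R) →
                  sum (map f parts) ≡ k * f P + (f B + k * f R)
      sum-parts f invP invR = begin
        sum (map f parts)                                           ≡⟨ cong sum (map-++ f (pieces k P) (B ∷ pieces k R)) ⟩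
        sum (map f (pieces k P) ++ map f (B ∷ pieces k R))          ≡⟨ sum-++ (map f (pieces k P)) _ ⟩
        sum (map f (pieces k P)) + (f B + sum (map f (pieces k R))) ≡⟨ cong₂ (λ x y → x + (f B + y))
                                                                         (sum-map-pieces k P f invP)
                                                                         (sum-map-pieces k R f invR) ⟩
        k * f P + (f B + k * f R)                                   ∎
        where open ≡-Reasoning

      regroup : ∀ a b c x y → a + (c * x + (b + c * y)) ≡ (a + b) + c * (x + y)
      regroup = solve-∀

      eA eB : ℕ
      eA = proj₁ (C4-tgt c4A)
      eB = proj₁ (C4-tgt c4B)

      eA≤2 : eA ≤ 2
      eA≤2 = proj₁ (proj₂ (C4-tgt c4A))
      eB≤2 : eB ≤ 2
      eB≤2 = proj₁ (proj₂ (C4-tgt c4B))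

      tgtA : index (tgt A) ≡ p + eA
      tgtA = proj₂ (proj₂ (C4-tgt c4A))
      tgtB : index (tgt B) ≡ p + eB
      tgtB = proj₂ (proj₂ (C4-tgt c4B))

      srcA : index (src A) ≡ eB
      srcA = trans (cong index A-after-B) (index-rho-m∸p (tgt B) eB≤2 tgtB)
      srcB : index (src B) ≡ eA
      srcB = trans (cong index B-after-A) (index-rho-m∸p (tgt A) eA≤2 tgtA)

      srcP∈V1 : InV1 p (src P)
      srcP∈V1 = near-p-in-V1 (src P) eA≤2 (trans (cong index (sym A→P)) tgtA)
      srcR∈V1 : InV1 p (src R)
      srcR∈V1 = near-p-in-V1 (src R) eB≤2 (trans (cong index (sym B→R)) tgtB)

      arcSumAB : arcSumW A + arcSumW B ≡ p + p
      arcSumAB = +-crossed {x = eB} {y = eA} {p = p}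
        (trans (cong (_+ arcSumW A) (sym srcA)) (trans (layer0-arcSumW A walkA c4A (subst (_≤ 2) (sym srcA) eB≤2)) tgtA))
        (trans (cong (_+ arcSumW B) (sym srcB)) (trans (layer0-arcSumW B walkB c4B (subst (_≤ 2) (sym srcB) eA≤2)) tgtB))

    C : Walk m
    C = cycleOf k A P B R

    P-in-V1 : All (InV1 p) (initV P)
    P-in-V1 = All-initV P srcP∈V1 (proj₂ c6P)

    R-in-V1 : All (InV1 p) (initV R)
    R-in-V1 = All-initV R srcR∈V1 (proj₂ c6R)

    cycle-closed : tgt C ≡ src C
    cycle-closed = trans (tgt-concatW A parts chain) (sym (src-concatW A parts))

    cycle-walk : IsWalk C
    cycle-walk = concatW-walk A parts chain walkA (All.++⁺ (pieces-walk k P walkP) (walkB ∷ pieces-walk k R walkR))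

    cycle-len : len C ≡ m
    cycle-len = begin
      len C                                     ≡⟨ len-concatW A parts ⟩
      len A + sum (map len parts)               ≡⟨ cong (len A +_) lens ⟩
      len A + (k * len P + (len B + k * len R)) ≡⟨ regroup (len A) (len B) k (len P) (len R) ⟩
      (len A + len B) + k * (len P + len R)     ≡⟨ cong₂ (λ x y → x + k * y) lenAB lenPR ⟩
      p + k * 12                                ≡⟨ cong (p +_) (*-comm k 12) ⟩
      m                                         ∎
      where
      open ≡-Reasoning
      lens : sum (map len parts) ≡ k * len P + (len B + k * len R)
      lens = sum-parts len (λ j → len-shiftW j P) (λ j → len-shiftW j R)

    cycle-arcSum : arcSumW C ≡ 2 * m
    cycle-arcSum = begin
      arcSumW C                                                 ≡⟨ arcSumW-concatW A parts chain ⟩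
      arcSumW A + sum (map arcSumW parts)                       ≡⟨ cong (arcSumW A +_) sums ⟩
      arcSumW A + (k * arcSumW P + (arcSumW B + k * arcSumW R)) ≡⟨ regroup (arcSumW A) (arcSumW B) k (arcSumW P) (arcSumW R) ⟩
      (arcSumW A + arcSumW B) + k * (arcSumW P + arcSumW R)     ≡⟨ cong₂ (λ x y → x + k * y) arcSumAB pieces12 ⟩
      (p + p) + k * 24                                          ≡⟨ double p k ⟩
      2 * m                                                     ∎
      where
      open ≡-Reasoning
      sums : sum (map arcSumW parts) ≡ k * arcSumW P + (arcSumW B + k * arcSumW R)
      sums = sum-parts arcSumW (λ j → arcSumW-shiftW j P) (λ j → arcSumW-shiftW j R)
      pieces12 : arcSumW P + arcSumW R ≡ 24
      pieces12 = cong₂ _+_ (piece-arcSumW P walkP c6P srcP∈V1) (piece-arcSumW R walkR c6R srcR∈V1)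
      double : ∀ p k → (p + p) + k * 24 ≡ 2 * (p + 12 * k)
      double = solve-∀

    cycle-initV : initV C ≡ initV A ++ initVs (pieces k P) ++ initV B ++ initVs (pieces k R)
    cycle-initV = trans (initV-concatW A parts chain)
                        (cong (initV A ++_) (concatMap-++ initV (pieces k P) (B ∷ pieces k R)))

  InV0? : Decidable (InV0 {m} p)
  InV0? v = index v <? p

  basicSet2⇒Cm-factor⁺ : ∀ (W X Y Z Q R S T : Walk m) → BasicSet2 p k W X Y Z Q R S T →
    IsType2Cycle (cycleOf k W Q X R) × IsType2Cycle (cycleOf k Y S Z T) ×
    IsCmFactor (cycleOf k W Q X R ∷ cycleOf k Y S Z T ∷ [])
  basicSet2⇒Cm-factor⁺ W X Y Z Q R S T
    ((dipW , dipX , dipY , dipZ , dipQ , dipR , dipS , dipT) , (disjQRST , disjWXYZ , _) ,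
     (c2WX , c2XW , c2YZ , c2ZY) , (lenWX , lenYZ , lenQRST , _) , (c4W , c4X , c4Y , c4Z) ,
     (c5W , c5X , c5Y , c5Z) , c6)
    with lenQRST (s≤s z≤n) | c6 (s≤s z≤n)
  ... | lenQR , lenST | c6Q , c6R , c6S , c6T =
    closed-walks-factor C₀.C C₁.C C₀.cycle-walk C₁.cycle-walk C₀.cycle-closed C₁.cycle-closed
      C₀.cycle-len C₁.cycle-len C₀.cycle-arcSum C₁.cycle-arcSum
      (subst Unique (sym (cong₂ _++_ C₀.cycle-initV C₁.cycle-initV))
        (Unique-interleave InV0?
          (proj₁ c4W) (initVs-pieces-above-V0 Q C₀.P-in-V1) (proj₁ c4X) (initVs-pieces-above-V0 R C₀.R-in-V1)
          (proj₁ c4Y) (initVs-pieces-above-V0 S C₁.P-in-V1) (proj₁ c4Z) (initVs-pieces-above-V0 T C₁.R-in-V1)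
          (subst Unique (concat-four (initV W) (initV X) (initV Y) (initV Z))
            (initVs-unique (W ∷ X ∷ Y ∷ Z ∷ [])
              (proj₂ dipW ∷ proj₂ dipX ∷ proj₂ dipY ∷ proj₂ dipZ ∷ []) (disjWXYZ (s≤s z≤n))))
          (subst Unique (concat-four (translates Q) (translates R) (translates S) (translates T))
            (initVs-translates-unique (Q ∷ R ∷ S ∷ T ∷ [])
              (C₀.P-in-V1 ∷ C₀.R-in-V1 ∷ C₁.P-in-V1 ∷ C₁.R-in-V1 ∷ [])
              (proj₂ dipQ ∷ proj₂ dipR ∷ proj₂ dipS ∷ proj₂ dipT ∷ []) disjQRST))))
    where
    module C₀ = HalfBasicSet W X Q R (proj₁ dipW) (proj₁ dipX) (proj₁ dipQ) (proj₁ dipR)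
                  c2WX c2XW lenWX lenQR c4W c4X c5W c5X c6Q c6R
    module C₁ = HalfBasicSet Y Z S T (proj₁ dipY) (proj₁ dipZ) (proj₁ dipS) (proj₁ dipT)
                  c2YZ c2ZY lenYZ lenST c4Y c4Z c5Y c5Z c6S c6T
    translates : Walk m → List (Vtx m)
    translates P = initVs (pieces k P)

basicSet2⇒Cm-factor : ∀ p k → 3 ≤ p → (W X Y Z Q R S T : Walk (p + 12 * k)) →
  BasicSet2 p k W X Y Z Q R S T →
  IsType2Cycle (cycleOf k W Q X R) × IsType2Cycle (cycleOf k Y S Z T) ×
  IsCmFactor (cycleOf k W Q X R ∷ cycleOf k Y S Z T ∷ [])
basicSet2⇒Cm-factor p zero _ W X Y Z Q R S T (_ , (_ , _ , k≡0⇒cycles) , _) with k≡0⇒cycles refl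
... | cyc₀ , cyc₁ , disj = cyc₀ , cyc₁ , two-cycles-factor (proj₁ cyc₀) (proj₁ cyc₁) disj
basicSet2⇒Cm-factor (suc p′) (suc k′) (s≤s 2≤p′) = basicSet2⇒Cm-factor⁺ p′ k′ 2≤p′

lemma15 : (p k : ℕ) → (p ≡ 11 ⊎ p ≡ 13 ⊎ p ≡ 17 ⊎ p ≡ 19)
    → (W X Y Z P00 P10 Q00 Q10 : Walk (p + 12 * k))
    → BasicSet2 p k W X Y Z P00 P10 Q00 Q10
    → IsType2Cycle (cycleOf k W P00 X P10)
      × IsType2Cycle (cycleOf k Y Q00 Z Q10)
      × IsCmFactor (cycleOf k W P00 X P10 ∷ cycleOf k Y Q00 Z Q10 ∷ [])
lemma15 p k p∈ = basicSet2⇒Cm-factor p k (3≤p p∈)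
  where
  3≤p : ∀ {p} → p ≡ 11 ⊎ p ≡ 13 ⊎ p ≡ 17 ⊎ p ≡ 19 → 3 ≤ p
  3≤p (inj₁ refl)               = s≤s (s≤s (s≤s z≤n))
  3≤p (inj₂ (inj₁ refl))        = s≤s (s≤s (s≤s z≤n))
  3≤p (inj₂ (inj₂ (inj₁ refl))) = s≤s (s≤s (s≤s z≤n))
  3≤p (inj₂ (inj₂ (inj₂ refl))) = s≤s (s≤s (s≤s z≤n))
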